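{- Let $\lambda$ be a nonzero real number and let $(a_{n,\lambda})_{n\ge0}$, $(b_{n,\lambda})_{n\ge0}$ be sequences of complex numbers. Then $$a_{n,\lambda}=\sum_{k=0}^{n}\binom{n}{k}(1)_{n-k,\lambda}\,b_{k,\lambda}\ \text{ for all } n\ge0$$ if and only if $$b_{n,\lambda}=\sum_{k=0}^{n}\binom{n}{k}(-1)^{n-k}\langle 1\rangle_{n-k,\lambda}\,a_{k,\lambda}\ \text{ for all } n\ge0.$$
   Context: For a nonzero real $\lambda$: $(x)_{0,\lambda}=1$, $(x)_{n,\lambda}=x(x-\lambda)\cdots(x-(n-1)\lambda)$ and $\langle x\rangle_{0,\lambda}=1$, $\langle x\rangle_{n,\lambda}=x(x+\lambda)\cdots(x+(n-1)\lambda)$ for $n\ge1$. -}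

module Defs where

open import Level using (Level)
open import Data.Nat using (ℕ; zero; suc)
open import Data.Nat.Combinatorics using (_C_)
open import Algebra.Bundles using (CommutativeRing)

-- All notions are defined over an arbitrary commutative ring R
-- (in the paper R = ℂ and λ is a nonzero real, viewed in ℂ).
module Ops {c ℓ : Level} (R : CommutativeRing c ℓ) where
  open CommutativeRing R hiding (zero)

  fromℕ : ℕ → Carrier
  fromℕ zero    = 0#
  fromℕ (suc n) = 1# + fromℕ n

  falling : Carrier → ℕ → Carrier → Carrier
  falling x zero    lam = 1#
  falling x (suc n) lam = falling x n lam * (x - fromℕ n * lam)

  rising : Carrier → ℕ → Carrier → Carrier
  rising x zero    lam = 1#
  rising x (suc n) lam = rising x n lam * (x + fromℕ n * lam)

  signPow : ℕ → Carrier
  signPow zero    = 1#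
  signPow (suc n) = - 1# * signPow n

  sumTo : ℕ → (ℕ → Carrier) → Carrier
  sumTo zero    f = f zero
  sumTo (suc n) f = sumTo n f + f (suc n)

  binom : ℕ → ℕ → Carrier
  binom n k = fromℕ (n C k)

-- Binomial convolution (f ⋆ g) n = Σₖ C(n,k) f(n−k) g(k) is associative with unit
-- δ = (1, 0, 0, …), and the generalized falling factorials obey the binomial theorem
-- (x)_{n,λ} ⋆ (y)_{n,λ} = (x + y)_{n,λ}. Since (−1)ⁿ ⟨1⟩_{n,λ} = (−1)_{n,λ}, the sequences
-- (1)_{n,λ} and (−1)ⁿ ⟨1⟩_{n,λ} convolve to (0)_{n,λ} = δ in either order, so they are
-- mutually inverse and a = (1)_λ ⋆ b is equivalent to b = ((−1)ⁿ ⟨1⟩_λ) ⋆ a.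
module Submission where

open import Defs
open import Level using (Level)
open import Data.Nat using (ℕ; _∸_)
open import Relation.Nullary using (¬_)
open import Function.Bundles using (_⇔_)
open import Algebra.Bundles using (CommutativeRing)

open import Data.Nat as ℕ using (zero; suc; _≤_; z≤n)
import Data.Nat.Properties as ℕ
open import Data.Nat.Combinatorics using (_C_; nCn≡1; k>n⇒nCk≡0; nCk+nC[k+1]≡[n+1]C[k+1])
open import Function.Bundles using (mk⇔)
open import Function.Construct.Composition using (_⇔-∘_)
open import Relation.Binary.PropositionalEquality as ≡ using (_≡_; cong)
import Algebra.Solver.Ring.NaturalCoefficients.Default as NaturalCoefficients
import Algebra.Properties.Ring as RingProperties

module _ {c ℓ : Level} (R : CommutativeRing c ℓ) where
  open CommutativeRing R hiding (zero)
  open Ops R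
  open import Relation.Binary.Reasoning.Setoid setoid
  open NaturalCoefficients commutativeSemiring using (solve; _:=_; _:+_; _:*_)
  open RingProperties ring using (-1*x≈-x; -‿+-comm; -0#≈0#)

  Seq : Set c
  Seq = ℕ → Carrier

  infix 4 _≋_
  _≋_ : Seq → Seq → Set ℓ
  f ≋ g = ∀ n → f n ≈ g n

  shift : Seq → Seq
  shift f n = f (suc n)

  infixl 7 _·_
  _·_ : Carrier → Seq → Seq
  (a · f) n = a * f n

  infixl 6 _⊕_
  _⊕_ : Seq → Seq → Seq
  (f ⊕ g) n = f n + g n

  δ : Seq
  δ zero    = 1#
  δ (suc n) = 0#

  sumTo-cong : ∀ n {h h′ : ℕ → Carrier} → (∀ k → k ≤ n → h k ≈ h′ k) → sumTo n h ≈ sumTo n h′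
  sumTo-cong zero    e = e 0 z≤n
  sumTo-cong (suc n) e = +-cong (sumTo-cong n (λ k k≤n → e k (ℕ.m≤n⇒m≤1+n k≤n))) (e (suc n) ℕ.≤-refl)

  sumTo-+ : ∀ n (h h′ : ℕ → Carrier) → sumTo n (λ k → h k + h′ k) ≈ sumTo n h + sumTo n h′
  sumTo-+ zero    h h′ = refl
  sumTo-+ (suc n) h h′ = begin
    sumTo n (λ k → h k + h′ k) + (h (suc n) + h′ (suc n))
      ≈⟨ +-congʳ (sumTo-+ n h h′) ⟩
    (sumTo n h + sumTo n h′) + (h (suc n) + h′ (suc n))
      ≈⟨ solve 4 (λ a b x y → (a :+ b) :+ (x :+ y) := (a :+ x) :+ (b :+ y)) refl _ _ _ _ ⟩
    (sumTo n h + h (suc n)) + (sumTo n h′ + h′ (suc n)) ∎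

  sumTo-*ˡ : ∀ n a (h : ℕ → Carrier) → sumTo n (λ k → a * h k) ≈ a * sumTo n h
  sumTo-*ˡ zero    a h = refl
  sumTo-*ˡ (suc n) a h = trans (+-congʳ (sumTo-*ˡ n a h)) (sym (distribˡ a _ _))

  sumTo-zero : ∀ n (h : ℕ → Carrier) → (∀ k → k ≤ n → h k ≈ 0#) → sumTo n h ≈ 0#
  sumTo-zero n h e = trans (sumTo-cong n e) (sumTo-0# n)
    where
    sumTo-0# : ∀ n → sumTo n (λ _ → 0#) ≈ 0#
    sumTo-0# zero    = refl
    sumTo-0# (suc n) = trans (+-identityʳ _) (sumTo-0# n)

  sumTo-suc-head : ∀ n (h : ℕ → Carrier) → sumTo (suc n) h ≈ h 0 + sumTo n (λ k → h (suc k))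
  sumTo-suc-head zero    h = refl
  sumTo-suc-head (suc n) h = trans (+-congʳ (sumTo-suc-head n h)) (+-assoc _ _ _)

  fromℕ-+ : ∀ m n → fromℕ (m ℕ.+ n) ≈ fromℕ m + fromℕ n
  fromℕ-+ zero    n = sym (+-identityˡ _)
  fromℕ-+ (suc m) n = trans (+-congˡ (fromℕ-+ m n)) (sym (+-assoc _ _ _))

  fromℕ-≡ : ∀ {m n} → m ≡ n → fromℕ m ≈ fromℕ n
  fromℕ-≡ e = reflexive (cong fromℕ e)

  binom-pascal : ∀ n k → binom (suc n) (suc k) ≈ binom n k + binom n (suc k)
  binom-pascal n k =
    trans (fromℕ-≡ (≡.sym (nCk+nC[k+1]≡[n+1]C[k+1] n k))) (fromℕ-+ (n C k) (n C suc k))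

  binom-suc-self : ∀ n → binom n (suc n) ≈ 0#
  binom-suc-self n = fromℕ-≡ (k>n⇒nCk≡0 (ℕ.n<1+n n))

  binom-self : ∀ n → binom n n ≈ 1#
  binom-self n = trans (fromℕ-≡ (nCn≡1 n)) (+-identityʳ _)

  -- f ⋆ g is the product of the exponential generating functions of f and g, and shift is
  -- their derivative, so ⋆-leibniz is the product rule.
  infixl 7 _⋆_
  _⋆_ : Seq → Seq → Seq
  (f ⋆ g) n = sumTo n (λ k → binom n k * f (n ∸ k) * g k)

  ⋆-congˡ : ∀ f {g g′} → g ≋ g′ → f ⋆ g ≋ f ⋆ g′
  ⋆-congˡ f eg n = sumTo-cong n (λ k _ → *-congˡ (eg k))

  ⋆-congʳ : ∀ g {f f′} → f ≋ f′ → f ⋆ g ≋ f′ ⋆ g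
  ⋆-congʳ g ef n = sumTo-cong n (λ k _ → *-congʳ (*-congˡ (ef (n ∸ k))))

  ⋆-at-0 : ∀ f g → (f ⋆ g) 0 ≈ f 0 * g 0
  ⋆-at-0 f g = *-congʳ (trans (*-congʳ (+-identityʳ _)) (*-identityˡ _))

  ·-⋆ : ∀ a f g → (a · f) ⋆ g ≋ a · (f ⋆ g)
  ·-⋆ a f g n = trans (sumTo-cong n (λ k _ →
    solve 4 (λ b x y a → b :* (a :* x) :* y := a :* (b :* x :* y)) refl _ _ _ _)) (sumTo-*ˡ n a _)

  ⋆-· : ∀ a f g → f ⋆ (a · g) ≋ a · (f ⋆ g)
  ⋆-· a f g n = trans (sumTo-cong n (λ k _ →
    solve 4 (λ b x y a → b :* x :* (a :* y) := a :* (b :* x :* y)) refl _ _ _ _)) (sumTo-*ˡ n a _)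

  ⋆-distribʳ : ∀ f f′ g → (f ⊕ f′) ⋆ g ≋ f ⋆ g ⊕ f′ ⋆ g
  ⋆-distribʳ f f′ g n = trans (sumTo-cong n (λ k _ →
    solve 4 (λ b x x′ y → b :* (x :+ x′) :* y := b :* x :* y :+ b :* x′ :* y) refl _ _ _ _))
    (sumTo-+ n _ _)

  ⋆-distribˡ : ∀ f g g′ → f ⋆ (g ⊕ g′) ≋ f ⋆ g ⊕ f ⋆ g′
  ⋆-distribˡ f g g′ n = trans (sumTo-cong n (λ k _ → distribˡ _ _ _)) (sumTo-+ n _ _)

  suc-∸ : ∀ {n k} → k ≤ n → suc n ∸ k ≡ suc (n ∸ k)
  suc-∸ = ℕ.+-∸-assoc 1

  ⋆-leibniz : ∀ f g n → (f ⋆ g) (suc n) ≈ (shift f ⋆ g) n + (f ⋆ shift g) n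
  ⋆-leibniz f g n = begin
    (f ⋆ g) (suc n)
      ≈⟨ sumTo-suc-head n _ ⟩
    head + sumTo n (λ k → binom (suc n) (suc k) * f (n ∸ k) * g (suc k))
      ≈⟨ +-congˡ (sumTo-cong n (λ k _ → trans (*-congʳ (*-congʳ (binom-pascal n k)))
           (solve 4 (λ a b x y → (a :+ b) :* x :* y := b :* x :* y :+ a :* x :* y) refl _ _ _ _))) ⟩
    head + sumTo n (λ k → binom n (suc k) * f (n ∸ k) * g (suc k) + binom n k * f (n ∸ k) * g (suc k))
      ≈⟨ +-congˡ (sumTo-+ n _ _) ⟩
    head + (tail + (f ⋆ shift g) n)
      ≈⟨ +-assoc _ _ _ ⟨
    (head + tail) + (f ⋆ shift g) n
      ≈⟨ +-congʳ shift-f-⋆-g ⟨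
    (shift f ⋆ g) n + (f ⋆ shift g) n ∎
    where
    head tail : Carrier
    head = binom (suc n) 0 * f (suc n) * g 0
    tail = sumTo n (λ k → binom n (suc k) * f (n ∸ k) * g (suc k))
    h : ℕ → Carrier
    h k = binom n k * f (suc n ∸ k) * g k
    shift-f-⋆-g : (shift f ⋆ g) n ≈ head + tail
    shift-f-⋆-g = begin
      (shift f ⋆ g) n
        ≈⟨ sumTo-cong n (λ k k≤n → *-congʳ (*-congˡ (reflexive (cong f (≡.sym (suc-∸ k≤n)))))) ⟩
      sumTo n h
        ≈⟨ +-identityʳ _ ⟨
      sumTo n h + 0#
        ≈⟨ +-congˡ (trans (*-congʳ (*-congʳ (binom-suc-self n))) (trans (*-congʳ (zeroˡ _)) (zeroˡ _))) ⟨
      sumTo (suc n) h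
        ≈⟨ sumTo-suc-head n h ⟩
      head + tail ∎

  ⋆-assoc : ∀ f g h → (f ⋆ g) ⋆ h ≋ f ⋆ (g ⋆ h)
  ⋆-assoc f g h zero = begin
    ((f ⋆ g) ⋆ h) 0     ≈⟨ ⋆-at-0 (f ⋆ g) h ⟩
    (f ⋆ g) 0 * h 0     ≈⟨ *-congʳ (⋆-at-0 f g) ⟩
    f 0 * g 0 * h 0     ≈⟨ *-assoc _ _ _ ⟩
    f 0 * (g 0 * h 0)   ≈⟨ *-congˡ (⋆-at-0 g h) ⟨
    f 0 * (g ⋆ h) 0     ≈⟨ ⋆-at-0 f (g ⋆ h) ⟨
    (f ⋆ (g ⋆ h)) 0     ∎
  ⋆-assoc f g h (suc n) = begin
    ((f ⋆ g) ⋆ h) (suc n)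
      ≈⟨ ⋆-leibniz (f ⋆ g) h n ⟩
    (shift (f ⋆ g) ⋆ h) n + ((f ⋆ g) ⋆ shift h) n
      ≈⟨ +-congʳ (trans (⋆-congʳ h (⋆-leibniz f g) n) (⋆-distribʳ (shift f ⋆ g) (f ⋆ shift g) h n)) ⟩
    ((shift f ⋆ g) ⋆ h) n + ((f ⋆ shift g) ⋆ h) n + ((f ⋆ g) ⋆ shift h) n
      ≈⟨ +-cong (+-cong (⋆-assoc (shift f) g h n) (⋆-assoc f (shift g) h n)) (⋆-assoc f g (shift h) n) ⟩
    (shift f ⋆ (g ⋆ h)) n + (f ⋆ (shift g ⋆ h)) n + (f ⋆ (g ⋆ shift h)) n
      ≈⟨ +-assoc _ _ _ ⟩
    (shift f ⋆ (g ⋆ h)) n + ((f ⋆ (shift g ⋆ h)) n + (f ⋆ (g ⋆ shift h)) n)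
      ≈⟨ +-congˡ (trans (⋆-congˡ f (⋆-leibniz g h) n) (⋆-distribˡ f (shift g ⋆ h) (g ⋆ shift h) n)) ⟨
    (shift f ⋆ (g ⋆ h)) n + (f ⋆ shift (g ⋆ h)) n
      ≈⟨ ⋆-leibniz f (g ⋆ h) n ⟨
    (f ⋆ (g ⋆ h)) (suc n) ∎

  ⋆-identityˡ : ∀ f → δ ⋆ f ≋ f
  ⋆-identityˡ f zero = trans (⋆-at-0 δ f) (*-identityˡ _)
  ⋆-identityˡ f (suc n) = begin
    sumTo n h + binom (suc n) (suc n) * δ (n ∸ n) * f (suc n)
      ≈⟨ +-cong (sumTo-zero n h δ-vanishes)
                (*-congʳ (*-cong (binom-self (suc n)) (reflexive (cong δ (ℕ.n∸n≡0 n))))) ⟩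
    0# + 1# * 1# * f (suc n)
      ≈⟨ trans (+-identityˡ _) (trans (*-congʳ (*-identityˡ _)) (*-identityˡ _)) ⟩
    f (suc n) ∎
    where
    h : ℕ → Carrier
    h k = binom (suc n) k * δ (suc n ∸ k) * f k
    δ-vanishes : ∀ k → k ≤ n → h k ≈ 0#
    δ-vanishes k k≤n =
      trans (*-congʳ (*-congˡ (reflexive (cong δ (suc-∸ k≤n))))) (trans (*-congʳ (zeroʳ _)) (zeroˡ _))

  ⋆-inversion : ∀ {f g} → f ⋆ g ≋ δ → g ⋆ f ≋ δ → ∀ a b → (a ≋ f ⋆ b) ⇔ (b ≋ g ⋆ a)
  ⋆-inversion {f} {g} f⋆g≋δ g⋆f≋δ a b = mk⇔ to from
    where
    to : a ≋ f ⋆ b → b ≋ g ⋆ a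
    to a≋f⋆b n = sym (begin
      (g ⋆ a) n         ≈⟨ ⋆-congˡ g a≋f⋆b n ⟩
      (g ⋆ (f ⋆ b)) n   ≈⟨ ⋆-assoc g f b n ⟨
      ((g ⋆ f) ⋆ b) n   ≈⟨ ⋆-congʳ b g⋆f≋δ n ⟩
      (δ ⋆ b) n         ≈⟨ ⋆-identityˡ b n ⟩
      b n               ∎)
    from : b ≋ g ⋆ a → a ≋ f ⋆ b
    from b≋g⋆a n = begin
      a n               ≈⟨ ⋆-identityˡ a n ⟨
      (δ ⋆ a) n         ≈⟨ ⋆-congʳ a f⋆g≋δ n ⟨
      ((f ⋆ g) ⋆ a) n   ≈⟨ ⋆-assoc f g a n ⟩
      (f ⋆ (g ⋆ a)) n   ≈⟨ ⋆-congˡ f b≋g⋆a n ⟨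
      (f ⋆ b) n         ∎

  ≋-trans-⇔ : ∀ {f g h} → g ≋ h → (f ≋ g) ⇔ (f ≋ h)
  ≋-trans-⇔ g≋h = mk⇔ (λ f≋g n → trans (f≋g n) (g≋h n)) (λ f≋h n → trans (f≋h n) (sym (g≋h n)))

  module _ (lam : Carrier) where

    fallingSeq : Carrier → Seq
    fallingSeq x n = falling x n lam

    signedRising : Seq
    signedRising n = signPow n * rising 1# n lam

    falling-cong : ∀ {x y} n → x ≈ y → falling x n lam ≈ falling y n lam
    falling-cong zero    e = refl
    falling-cong (suc n) e = *-cong (falling-cong n e) (+-cong e refl)

    falling-suc-head : ∀ x n → falling x (suc n) lam ≈ x * falling (x - lam) n lam
    falling-suc-head x zero = begin
      1# * (x - 0# * lam)  ≈⟨ *-identityˡ _ ⟩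
      x - 0# * lam         ≈⟨ +-congˡ (trans (-‿cong (zeroˡ lam)) -0#≈0#) ⟩
      x + 0#               ≈⟨ +-identityʳ x ⟩
      x                    ≈⟨ *-identityʳ x ⟨
      x * 1#               ∎
    falling-suc-head x (suc n) = begin
      falling x (suc n) lam * (x - (1# + fromℕ n) * lam)
        ≈⟨ *-congʳ (falling-suc-head x n) ⟩
      x * falling (x - lam) n lam * (x - (1# + fromℕ n) * lam)
        ≈⟨ *-congˡ (+-congˡ (trans (-‿cong (trans (distribʳ lam 1# (fromℕ n)) (+-congʳ (*-identityˡ lam))))
                                    (sym (-‿+-comm _ _)))) ⟩
      x * falling (x - lam) n lam * (x + (- lam + - (fromℕ n * lam)))
        ≈⟨ solve 4 (λ x A m₁ m₂ → x :* A :* (x :+ (m₁ :+ m₂)) := x :* (A :* ((x :+ m₁) :+ m₂)))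
                 refl x _ _ _ ⟩
      x * falling (x - lam) (suc n) lam ∎

    falling-binomial : ∀ x y → fallingSeq x ⋆ fallingSeq y ≋ fallingSeq (x + y)
    falling-binomial x y zero = trans (⋆-at-0 (fallingSeq x) (fallingSeq y)) (*-identityˡ _)
    falling-binomial x y (suc n) = begin
      (F x ⋆ F y) (suc n)
        ≈⟨ ⋆-leibniz (F x) (F y) n ⟩
      (shift (F x) ⋆ F y) n + (F x ⋆ shift (F y)) n
        ≈⟨ +-cong shiftˡ shiftʳ ⟩
      x * (F (x - lam) ⋆ F y) n + y * (F x ⋆ F (y - lam)) n
        ≈⟨ +-cong (*-congˡ (falling-binomial (x - lam) y n)) (*-congˡ (falling-binomial x (y - lam) n)) ⟩
      x * F (x - lam + y) n + y * F (x + (y - lam)) n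
        ≈⟨ +-cong (*-congˡ (falling-cong n (solve 3 (λ x y m → x :+ y :+ m := x :+ m :+ y) refl x y (- lam))))
                  (*-congˡ (falling-cong n (+-assoc x y (- lam)))) ⟨
      x * F (x + y - lam) n + y * F (x + y - lam) n
        ≈⟨ distribʳ _ _ _ ⟨
      (x + y) * F (x + y - lam) n
        ≈⟨ falling-suc-head (x + y) n ⟨
      F (x + y) (suc n) ∎
      where
      F : Carrier → Seq
      F = fallingSeq
      shiftˡ : (shift (F x) ⋆ F y) n ≈ x * (F (x - lam) ⋆ F y) n
      shiftˡ = trans (⋆-congʳ (F y) (falling-suc-head x) n) (·-⋆ x (F (x - lam)) (F y) n)
      shiftʳ : (F x ⋆ shift (F y)) n ≈ y * (F x ⋆ F (y - lam)) n
      shiftʳ = trans (⋆-congˡ (F x) (falling-suc-head y) n) (⋆-· y (F x) (F (y - lam)) n)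

    falling-0#≋δ : fallingSeq 0# ≋ δ
    falling-0#≋δ zero    = refl
    falling-0#≋δ (suc n) = trans (falling-suc-head 0# n) (zeroˡ _)

    signedRising≋falling-1 : signedRising ≋ fallingSeq (- 1#)
    signedRising≋falling-1 zero    = *-identityˡ _
    signedRising≋falling-1 (suc m) = begin
      - 1# * signPow m * (rising 1# m lam * (1# + fromℕ m * lam))
        ≈⟨ solve 4 (λ m₁ s r t → m₁ :* s :* (r :* t) := s :* r :* (m₁ :* t)) refl (- 1#) _ _ _ ⟩
      signedRising m * (- 1# * (1# + fromℕ m * lam))
        ≈⟨ *-congˡ (trans (-1*x≈-x _) (sym (-‿+-comm _ _))) ⟩
      signedRising m * (- 1# - fromℕ m * lam)
        ≈⟨ *-congʳ (signedRising≋falling-1 m) ⟩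
      falling (- 1#) (suc m) lam ∎

    falling-inverse : ∀ x y → x + y ≈ 0# → fallingSeq x ⋆ fallingSeq y ≋ δ
    falling-inverse x y x+y≈0 n =
      trans (falling-binomial x y n) (trans (falling-cong n x+y≈0) (falling-0#≋δ n))

    falling1⋆signedRising≋δ : fallingSeq 1# ⋆ signedRising ≋ δ
    falling1⋆signedRising≋δ n = trans (⋆-congˡ (fallingSeq 1#) signedRising≋falling-1 n)
                                      (falling-inverse 1# (- 1#) (-‿inverseʳ 1#) n)

    signedRising⋆falling1≋δ : signedRising ⋆ fallingSeq 1# ≋ δ
    signedRising⋆falling1≋δ n = trans (⋆-congʳ (fallingSeq 1#) signedRising≋falling-1 n)
                                      (falling-inverse (- 1#) 1# (-‿inverseˡ 1#) n)

    signedRising-⋆ : ∀ a → signedRising ⋆ a ≋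
      λ n → sumTo n (λ k → binom n k * signPow (n ∸ k) * rising 1# (n ∸ k) lam * a k)
    signedRising-⋆ a n = sumTo-cong n (λ k _ → *-congʳ (sym (*-assoc _ _ _)))

theorem25 : {c ℓ : Level} (R : CommutativeRing c ℓ) →
    let open CommutativeRing R
        open Ops R
    in (lam : Carrier) → ¬ (lam ≈ 0#) → (a b : ℕ → Carrier) →
       ((n : ℕ) → a n ≈ sumTo n (λ k → binom n k * falling 1# (n ∸ k) lam * b k))
       ⇔
       ((n : ℕ) → b n ≈ sumTo n (λ k → binom n k * signPow (n ∸ k) * rising 1# (n ∸ k) lam * a k))
theorem25 R lam _ a b =
  ≋-trans-⇔ R (signedRising-⋆ R lam a)
    ⇔-∘ ⋆-inversion R (falling1⋆signedRising≋δ R lam) (signedRising⋆falling1≋δ R lam) a b
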